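{- Let $m\in\mathbb{Z}_{\geq1}$ and $r'\in\mathbb{Z}_{\geq 0}$ be fixed. Let $r\in\{0,\ldots,5\}$ and $k:\mathbb{Z}\to\mathbb{Z}$ be such that $6mk'+r'=6k(k')+r$ for all $k'\in\mathbb{Z}_{\geq0}$. Let $\ell_1,\ell_2:\mathbb{Z}\to\mathbb{Z}$ and set $R(k')=\mathbb{Z}^2\cap\big([0,\ell_1(k')-1]\times[0,\ell_2(k')-1]\big)$. For each $i\in\{0,1,2\}$ and each $\mu\in H_{r+6i}$ let $\psi_\mu:\mathbb{R}^3\to\mathbb{R}^2$ be an affine linear function such that for every $s\in\mathbb{Z}_{\ge1}$ the restriction $\psi_\mu|_{T_s}$ is injective, and such that for every $k'\in\mathbb{Z}_{\ge0}$ the sets $\psi_\mu(T_{k(k')-i})$, for $i\in\{0,1,2\}$ and $\mu\in H_{r+6i}$, are pairwise disjoint with union equal to $R(k')$. Define $\psi:Q_{k(k'),r}\to R(k')$ by $\psi(\mu,\tau)=\psi_\mu(\tau)$. Let $\eta:\mathbb{R}^2\to\{0,\ldots,m-1\}$ be of the form $\eta(x,y)=\alpha x+\beta y+\gamma \bmod m$ with $\alpha,\beta,\gamma\in\mathbb{Z}$. Suppose at least one of the following holds: (i) $\gcd(\alpha,m)=1$ and $m\mid \ell_1(k')$ for all $k'\ge0$; or (ii) $\gcd(\beta,m)=1$ and $m\mid\ell_2(k')$ for all $k'\ge0$. Then for every $k'\ge0$, the function $c=\eta\circ\psi\circ\phi_{k(k'),r}$ on $P(6mk'+r',3)$ takes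 each value $0,1,\ldots,m-1$ exactly $p(6mk'+r',3)/m$ times (in particular $p(6mk'+r',3)\equiv0\pmod m$). Moreover, letting $\delta=(1,0)$ in case (i) and $\delta=(0,1)$ in case (ii), the map $$\lambda\longmapsto(\psi\circ\phi_{k(k'),r})^{ -1}\big((\psi\circ\phi_{k(k'),r})(\lambda)+\delta\big),$$ where the addition in the first (resp. second) coordinate is taken modulo $\ell_1(k')$ (resp. $\ell_2(k')$) within $\{0,\ldots,\ell_1(k')-1\}$ (resp. $\{0,\ldots,\ell_2(k')-1\}$), is a permutation of $P(6mk'+r',3)$ all of whose cycles have length $\ell_1(k')$ (resp. $\ell_2(k')$).
   Context: $P(n,3)$ is the set of integer vectors $\lambda=(\lambda_1,\lambda_2,\lambda_3)$ with $\lambda_1+\lambda_2+\lambda_3=n$ and $\lambda_1\ge\lambda_2\ge\lambda_3>0$, and $p(n,3)=\#P(n,3)$. $V_3$ is the $3\times3$ matrix with columns $v_1=(6,0,0)$, $v_2=(3,3,0)$, $v_3=(2,2,2)$. $F_3=\mathbb{Z}^3\cap\{a v_1+b v_2+c v_3 : a,b\in[0,1),\ c\in(0,1]\}$; $H_i=\{\mu\in F_3:\mu_1+\mu_2+\mu_3=i\}$; $T_k=\{v\in\mathbb{Z}^3_{\ge0}:v_1+v_2+v_3=k\}$ (empty for $k<0$). For $k\ge0$, $r\in\{0,\ldots,5\}$: $Q_{k,r}=(H_r\times T_k)\cup(H_{6+r}\times T_{k-1})\cup(H_{12+r}\times T_{k-2})$, and $\phi_{k,r}:P(6k+r,3)\to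 Q_{k,r}$ sends $\lambda$ to the unique pair $(\mu,\tau)$ with $\mu\in F_3$, $\tau\in\mathbb{Z}^3_{\ge0}$, $\lambda=\mu+V_3\tau$ (this is a bijection).
   Formalization: Each affine map $\psi_\mu$ has rational coefficients rather than real ones. -}

module Defs where

open import Data.Nat as ℕ using (ℕ; zero; suc; NonZero)
open import Data.Integer as ℤ using (ℤ; +_; _%ℕ_)
open import Data.Rational as ℚ using (ℚ)
open import Data.Fin using (Fin)
open import Data.Product using (Σ; ∃; ∃-syntax; _×_; _,_)
open import Data.Sum using (_⊎_)
open import Relation.Binary.PropositionalEquality using (_≡_)
open import Relation.Nullary using (¬_)

V3 : Set
V3 = ℤ × ℤ × ℤ

toℚ : ℤ → ℚ
toℚ z = z ℚ./ 1

sum3 : V3 → ℤ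
sum3 (a , b , c) = a ℤ.+ b ℤ.+ c

_+V_ : V3 → V3 → V3
(a , b , c) +V (a' , b' , c') = (a ℤ.+ a' , b ℤ.+ b' , c ℤ.+ c')

-- V₃ τ where V₃ has columns v₁=(6,0,0), v₂=(3,3,0), v₃=(2,2,2)
V3mul : V3 → V3
V3mul (a , b , c) =
  ((+ 6) ℤ.* a ℤ.+ (+ 3) ℤ.* b ℤ.+ (+ 2) ℤ.* c , (+ 3) ℤ.* b ℤ.+ (+ 2) ℤ.* c , (+ 2) ℤ.* c)

InP : ℤ → V3 → Set
InP n (l₁ , l₂ , l₃) = (l₁ ℤ.+ l₂ ℤ.+ l₃ ≡ n) × (l₂ ℤ.≤ l₁) × (l₃ ℤ.≤ l₂) × (ℤ.0ℤ ℤ.< l₃)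

-- F₃ = ℤ³ ∩ { a v₁ + b v₂ + c v₃ : a,b ∈ [0,1), c ∈ (0,1] }
-- (coefficients are taken rational: since V₃ is invertible over ℚ, a real
-- solution for an integer μ is automatically rational)

InF3 : V3 → Set
InF3 (μ₁ , μ₂ , μ₃) =
  ∃[ a ] ∃[ b ] ∃[ c ]
    (0ℚ ℚ.≤ a) × (a ℚ.< 1ℚ) × (0ℚ ℚ.≤ b) × (b ℚ.< 1ℚ) × (0ℚ ℚ.< c) × (c ℚ.≤ 1ℚ) ×
    (toℚ μ₁ ≡ toℚ (+ 6) ℚ.* a ℚ.+ toℚ (+ 3) ℚ.* b ℚ.+ toℚ (+ 2) ℚ.* c) ×
    (toℚ μ₂ ≡ toℚ (+ 3) ℚ.* b ℚ.+ toℚ (+ 2) ℚ.* c) ×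
    (toℚ μ₃ ≡ toℚ (+ 2) ℚ.* c)
  where
    0ℚ 1ℚ : ℚ
    0ℚ = ℚ.0ℚ
    1ℚ = ℚ.1ℚ

InH : ℤ → V3 → Set
InH i μ = InF3 μ × (sum3 μ ≡ i)

NonNeg : V3 → Set
NonNeg (a , b , c) = (ℤ.0ℤ ℤ.≤ a) × (ℤ.0ℤ ℤ.≤ b) × (ℤ.0ℤ ℤ.≤ c)

InT : ℤ → V3 → Set
InT s τ = NonNeg τ × (sum3 τ ≡ s)

-- φ_{k,r}(λ) = (μ , τ) is the unique pair with μ ∈ F₃, τ ∈ ℤ³_{≥0},
-- λ = μ + V₃ τ.  We record it as a relation (the graph of φ).
Decomp : V3 → V3 → V3 → Set
Decomp l μ τ = InF3 μ × NonNeg τ × (l ≡ μ +V V3mul τ)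

-- Affine maps ℝ³ → ℝ², with (rational) coefficients, evaluated at
-- integer points:  x ↦ A x + b

record Affine : Set where
  field
    a₁₁ a₁₂ a₁₃ a₂₁ a₂₂ a₂₃ b₁ b₂ : ℚ

app : Affine → V3 → ℚ × ℚ
app f (x , y , z) =
  ( a₁₁ ℚ.* toℚ x ℚ.+ a₁₂ ℚ.* toℚ y ℚ.+ a₁₃ ℚ.* toℚ z ℚ.+ b₁
  , a₂₁ ℚ.* toℚ x ℚ.+ a₂₂ ℚ.* toℚ y ℚ.+ a₂₃ ℚ.* toℚ z ℚ.+ b₂ )
  where open Affine f

pt : ℤ → ℤ → ℚ × ℚ
pt x y = (toℚ x , toℚ y)

Idx : ℕ → ℕ → V3 → Set
Idx r i μ = (i ℕ.≤ 2) × InH (+ (r ℕ.+ 6 ℕ.* i)) μ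

InR : ℤ → ℤ → ℤ → ℤ → Set
InR ℓ₁ ℓ₂ x y = (ℤ.0ℤ ℤ.≤ x) × (x ℤ.≤ ℓ₁ ℤ.- ℤ.1ℤ) × (ℤ.0ℤ ℤ.≤ y) × (y ℤ.≤ ℓ₂ ℤ.- ℤ.1ℤ)

-- Hypotheses on the family ψ (indexed by μ; only μ in the index set matter)
-- for given r and a given value K = k(k') and rectangle sides ℓ₁, ℓ₂.
PsiInjective : ℕ → (V3 → Affine) → Set
PsiInjective r ψ =
  ∀ i μ → Idx r i μ → ∀ (s : ℤ) → ℤ.1ℤ ℤ.≤ s →
    ∀ τ τ' → InT s τ → InT s τ' → app (ψ μ) τ ≡ app (ψ μ) τ' → τ ≡ τ'

PsiTiling : ℕ → (V3 → Affine) → ℤ → ℤ → ℤ → Set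
PsiTiling r ψ K ℓ₁ ℓ₂ =
  (∀ i i' μ μ' τ τ' → Idx r i μ → Idx r i' μ' →
     InT (K ℤ.- + i) τ → InT (K ℤ.- + i') τ' →
     app (ψ μ) τ ≡ app (ψ μ') τ' → μ ≡ μ') ×
  (∀ i μ τ → Idx r i μ → InT (K ℤ.- + i) τ →
     ∃[ x ] ∃[ y ] (InR ℓ₁ ℓ₂ x y × (app (ψ μ) τ ≡ pt x y))) ×
  (∀ x y → InR ℓ₁ ℓ₂ x y →
     ∃[ i ] ∃[ μ ] ∃[ τ ] (Idx r i μ × InT (K ℤ.- + i) τ × (app (ψ μ) τ ≡ pt x y)))

PsiPhi : (V3 → Affine) → V3 → ℤ → ℤ → Set
PsiPhi ψ l x y = ∃[ μ ] ∃[ τ ] (Decomp l μ τ × (app (ψ μ) τ ≡ pt x y))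

eta : (m : ℕ) → .{{NonZero m}} → ℤ → ℤ → ℤ → ℤ → ℤ → ℕ
eta m α β γ x y = (α ℤ.* x ℤ.+ β ℤ.* y ℤ.+ γ) %ℕ m

Colour : (m : ℕ) → .{{NonZero m}} → (V3 → Affine) → ℤ → ℤ → ℤ → V3 → ℕ → Set
Colour m ψ α β γ l j = ∃[ x ] ∃[ y ] (PsiPhi ψ l x y × (eta m α β γ x y ≡ j))

-- Cardinality of a subset S of ℤ³: an enumeration Fin N → ℤ³ that is
-- injective with image exactly S.
HasCard : (V3 → Set) → ℕ → Set
HasCard S N =
  Σ (Fin N → V3) λ f →
    (∀ i → S (f i)) × (∀ i j → f i ≡ f j → i ≡ j) × (∀ x → S x → ∃[ i ] (f i ≡ x))

iter : (V3 → V3) → ℕ → V3 → V3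
iter σ zero x = x
iter σ (suc j) x = σ (iter σ j x)

PermCycles : (V3 → Set) → (V3 → V3) → ℕ → Set
PermCycles S σ L =
  (∀ x → S x → S (σ x)) ×
  (Σ (V3 → V3) λ ρ → ((∀ x → S x → S (ρ x)) × (∀ x → S x → ρ (σ x) ≡ x) × (∀ x → S x → σ (ρ x) ≡ x))) ×
  (∀ x → S x → iter σ L x ≡ x) ×
  (∀ x → S x → ∀ j → 0 ℕ.< j → j ℕ.< L → ¬ (iter σ j x ≡ x))

module Submission where

-- Write n = 6mk′ + r′ = 6K + r. The decomposition λ = μ + V₃τ splits P(n,3) into the blocks
-- H_{r+6i} × T_{K−i}, i ≤ 2 (the parts of μ ∈ F₃ sum to less than 18), and the tiling hypothesis lays
-- these blocks out over the rectangle R = [0,ℓ₁) × [0,ℓ₂) through the maps ψ_μ. So ψ ∘ φ is a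
-- bijection from P(n,3) onto the integer points of R, and everything is read off in the coordinates
-- (x, y). If m ∣ ℓ₁ and α is invertible mod m, the points of a row y with αx + βy + γ ≡ j (mod m) are
-- those with x ≡ α⁻¹(j − βy − γ) (mod m), exactly ℓ₁/m of them; and x ↦ x + 1 mod ℓ₁ is a permutation
-- whose cycles are the rows, each of length ℓ₁. Case (ii) is case (i) with the coordinates exchanged.

open import Defs
open import Data.Nat as ℕ using (ℕ; NonZero)
open import Data.Integer as ℤ using (ℤ; +_; ∣_∣)
open import Data.Integer.GCD using (gcd)
open import Data.Integer.Divisibility as ℤd using ()
open import Data.Nat.Divisibility as ℕd using ()
open import Data.Product using (Σ; ∃; ∃-syntax; _×_; _,_)
open import Relation.Binary.PropositionalEquality using (_≡_)

open import Data.Nat using (zero; suc; z≤n; s≤s; _%_; _/_)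
open import Data.Integer using (-[1+_]; _%ℕ_; +≤+; +<+)
open import Data.Rational as ℚ using (ℚ; mkℚ)
open import Data.Fin as Fin using (Fin; toℕ; fromℕ<)
open import Data.Product using (proj₁; proj₂)
open import Data.Unit using (⊤; tt)
open import Relation.Nullary using (¬_; Dec; yes; no; contradiction)
open import Relation.Nullary.Decidable using (_×-dec_; from-yes)
open import Relation.Binary.PropositionalEquality
  using (_≢_; refl; sym; trans; cong; cong₂; subst; subst₂; module ≡-Reasoning)
open import Relation.Binary.Bundles using (Setoid)
open import Data.Integer.Divisibility.Signed as ℤs using (divides)
import Data.Nat.Properties as ℕP
import Data.Nat.DivMod as ℕD
import Data.Nat.GCD as ℕGCD
import Data.Nat.Coprimality as ℕC
import Data.Nat.Tactic.RingSolver as ℕSolver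
import Data.Integer.Properties as ℤP
import Data.Integer.DivMod as ℤD
import Data.Integer.Tactic.RingSolver as ℤSolver
import Data.Rational.Properties as ℚP
import Data.Fin.Properties as FinP

infix 4 _≡_mod_

record _≡_mod_ (a b : ℤ) (m : ℕ) : Set where
  constructor congruence
  field divides-difference : + m ℤs.∣ a ℤ.- b

module _ {m : ℕ} where

  ≡⇒≡-mod : ∀ {a b} → a ≡ b → a ≡ b mod m
  ≡⇒≡-mod {a} refl = congruence (divides ℤ.0ℤ (ℤP.+-inverseʳ a))

  ≡-mod-sym : ∀ {a b} → a ≡ b mod m → b ≡ a mod m
  ≡-mod-sym {a} {b} (congruence m∣a-b) = congruence (subst (+ m ℤs.∣_) (flip a b) (ℤs.∣m⇒∣-m m∣a-b))
    where
    flip : ∀ a b → ℤ.- (a ℤ.- b) ≡ b ℤ.- a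
    flip = ℤSolver.solve-∀

  ≡-mod-trans : ∀ {a b c} → a ≡ b mod m → b ≡ c mod m → a ≡ c mod m
  ≡-mod-trans {a} {b} {c} (congruence m∣a-b) (congruence m∣b-c) =
    congruence (subst (+ m ℤs.∣_) (telescope a b c) (ℤs.∣m∣n⇒∣m+n m∣a-b m∣b-c))
    where
    telescope : ∀ a b c → a ℤ.- b ℤ.+ (b ℤ.- c) ≡ a ℤ.- c
    telescope = ℤSolver.solve-∀

  +-cong-mod : ∀ {a b c d} → a ≡ b mod m → c ≡ d mod m → a ℤ.+ c ≡ b ℤ.+ d mod m
  +-cong-mod {a} {b} {c} {d} (congruence m∣a-b) (congruence m∣c-d) =
    congruence (subst (+ m ℤs.∣_) (regroup a b c d) (ℤs.∣m∣n⇒∣m+n m∣a-b m∣c-d))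
    where
    regroup : ∀ a b c d → a ℤ.- b ℤ.+ (c ℤ.- d) ≡ a ℤ.+ c ℤ.- (b ℤ.+ d)
    regroup = ℤSolver.solve-∀

  *-congˡ-mod : ∀ c {a b} → a ≡ b mod m → c ℤ.* a ≡ c ℤ.* b mod m
  *-congˡ-mod c {a} {b} (congruence m∣a-b) = congruence (subst (+ m ℤs.∣_) (distrib c a b) (ℤs.∣n⇒∣m*n c m∣a-b))
    where
    distrib : ∀ c a b → c ℤ.* (a ℤ.- b) ≡ c ℤ.* a ℤ.- c ℤ.* b
    distrib = ℤSolver.solve-∀

  *-congʳ-mod : ∀ c {a b} → a ≡ b mod m → a ℤ.* c ≡ b ℤ.* c mod m
  *-congʳ-mod c {a} {b} a≡b = subst₂ (_≡_mod m) (ℤP.*-comm c a) (ℤP.*-comm c b) (*-congˡ-mod c a≡b)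

  ≡-mod-setoid : Setoid _ _
  ≡-mod-setoid = record
    { Carrier = ℤ
    ; _≈_ = λ a b → a ≡ b mod m
    ; isEquivalence = record { refl = ≡⇒≡-mod refl ; sym = ≡-mod-sym ; trans = ≡-mod-trans }
    }

module _ {m : ℕ} .{{_ : NonZero m}} where

  %ℕ-≡-mod : ∀ z → z ≡ + (z %ℕ m) mod m
  %ℕ-≡-mod z = congruence (divides (z ℤ./ℕ m) (begin
    z ℤ.- + (z %ℕ m)                              ≡⟨ cong (ℤ._- + (z %ℕ m)) (ℤD.a≡a%ℕn+[a/ℕn]*n z m) ⟩
    + (z %ℕ m) ℤ.+ z ℤ./ℕ m ℤ.* + m ℤ.- + (z %ℕ m) ≡⟨ cancel (+ (z %ℕ m)) (z ℤ./ℕ m ℤ.* + m) ⟩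
    z ℤ./ℕ m ℤ.* + m                              ∎))
    where
    open ≡-Reasoning
    cancel : ∀ r q → r ℤ.+ q ℤ.- r ≡ q
    cancel = ℤSolver.solve-∀

  ≡-mod⇒≡ : ∀ {x y} → x ℕ.< m → y ℕ.< m → + x ≡ + y mod m → x ≡ y
  ≡-mod⇒≡ {x} {y} x<m y<m x≡y = ℤP.+-injective (ℤP.i-j≡0⇒i≡j (+ x) (+ y) (ℤP.∣i∣≡0⇒i≡0 ∣x-y∣≡0))
    where
    ∣x-y∣<m : ∣ + x ℤ.- + y ∣ ℕ.< m
    ∣x-y∣<m = subst (ℕ._< m) (cong ∣_∣ (sym (ℤP.m-n≡m⊖n x y)))
                (ℕP.≤-<-trans (ℤP.∣m⊝n∣≤m⊔n x y) (ℕP.⊔-lub x<m y<m))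
    ∣x-y∣≡0 : ∣ + x ℤ.- + y ∣ ≡ 0
    ∣x-y∣≡0 with ∣ + x ℤ.- + y ∣ in eq
    ... | zero  = refl
    ... | suc _ = contradiction (subst (m ℕd.∣_) eq (ℤs.∣⇒∣ᵤ (_≡_mod_.divides-difference x≡y))) (ℕd.>⇒∤ (subst (ℕ._< m) eq ∣x-y∣<m))

  ≡-mod⇒%ℕ≡ : ∀ {z u} → u ℕ.< m → z ≡ + u mod m → z %ℕ m ≡ u
  ≡-mod⇒%ℕ≡ {z} u<m z≡u = ≡-mod⇒≡ (ℤD.n%ℕd<d z m) u<m (≡-mod-trans (≡-mod-sym (%ℕ-≡-mod z)) z≡u)

  private
    pos-1+*≡ : ∀ {a b c d} → 1 ℕ.+ a ℕ.* b ≡ c ℕ.* d → ℤ.1ℤ ℤ.+ + a ℤ.* + b ≡ + c ℤ.* + d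
    pos-1+*≡ {a} {b} {c} {d} eq = begin
      ℤ.1ℤ ℤ.+ + a ℤ.* + b  ≡⟨ cong (λ t → ℤ.1ℤ ℤ.+ t) (ℤP.pos-* a b) ⟨
      + (1 ℕ.+ a ℕ.* b)     ≡⟨ cong +_ eq ⟩
      + (c ℕ.* d)           ≡⟨ ℤP.pos-* c d ⟩
      + c ℤ.* + d           ∎
      where open ≡-Reasoning

  ℕ-inverse-mod : ∀ {g} → ℕGCD.gcd g m ≡ 1 → ∃[ g⁻¹ ] (g⁻¹ ℤ.* + g ≡ ℤ.1ℤ mod m)
  ℕ-inverse-mod {g} gcd≡1 with ℕC.coprime-Bézout (ℕC.gcd≡1⇒coprime {g} {m} gcd≡1)
  ... | ℕGCD.Bézout.+- x y eq = + x , congruence (divides (+ y) (move (+ x ℤ.* + g) (+ y ℤ.* + m) (pos-1+*≡ {y} {m} {x} {g} eq)))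
    where
    move : ∀ X Y → ℤ.1ℤ ℤ.+ Y ≡ X → X ℤ.- ℤ.1ℤ ≡ Y
    move X Y refl = cancel Y
      where
      cancel : ∀ Y → ℤ.1ℤ ℤ.+ Y ℤ.- ℤ.1ℤ ≡ Y
      cancel = ℤSolver.solve-∀
  ... | ℕGCD.Bézout.-+ x y eq =
    ℤ.- + x , congruence (divides (ℤ.- + y) (negate (+ x) (+ g) (+ y) (+ m) (pos-1+*≡ {x} {g} {y} {m} eq)))
    where
    negate : ∀ x g y m → ℤ.1ℤ ℤ.+ x ℤ.* g ≡ y ℤ.* m → ℤ.- x ℤ.* g ℤ.- ℤ.1ℤ ≡ ℤ.- y ℤ.* m
    negate x g y m eq = trans (lhs x g) (trans (cong ℤ.-_ eq) (rhs y m))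
      where
      lhs : ∀ x g → ℤ.- x ℤ.* g ℤ.- ℤ.1ℤ ≡ ℤ.- (ℤ.1ℤ ℤ.+ x ℤ.* g)
      lhs = ℤSolver.solve-∀
      rhs : ∀ y m → ℤ.- (y ℤ.* m) ≡ ℤ.- y ℤ.* m
      rhs = ℤSolver.solve-∀

  inverse-mod : ∀ a → gcd a (+ m) ≡ + 1 → ∃[ a⁻¹ ] (a⁻¹ ℤ.* a ≡ ℤ.1ℤ mod m)
  inverse-mod (+ g) gcd≡1 = ℕ-inverse-mod {g} (ℤP.+-injective gcd≡1)
  inverse-mod -[1+ n ] gcd≡1 with ℕ-inverse-mod {suc n} (ℤP.+-injective gcd≡1)
  ... | g⁻¹ , inverse = ℤ.- g⁻¹ , subst (_≡ ℤ.1ℤ mod m) (neg-*-neg g⁻¹ (+ suc n)) inverse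
    where
    neg-*-neg : ∀ x y → x ℤ.* y ≡ ℤ.- x ℤ.* ℤ.- y
    neg-*-neg = ℤSolver.solve-∀

module LinearColouring (m : ℕ) .{{_ : NonZero m}} (a b c : ℤ) (coprime : gcd a (+ m) ≡ + 1) where

  private
    a⁻¹ : ℤ
    a⁻¹ = proj₁ (inverse-mod a coprime)

    a⁻¹a≡1 : a⁻¹ ℤ.* a ≡ ℤ.1ℤ mod m
    a⁻¹a≡1 = proj₂ (inverse-mod a coprime)

    open import Relation.Binary.Reasoning.Setoid (≡-mod-setoid {m})

    refl′ : ∀ {z} → z ≡ z mod m
    refl′ = ≡⇒≡-mod refl

  residue : ℕ → ℕ → ℕ
  residue j y = (a⁻¹ ℤ.* (+ j ℤ.- b ℤ.* + y ℤ.- c)) %ℕ m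

  residue<m : ∀ j y → residue j y ℕ.< m
  residue<m j y = ℤD.n%ℕd<d (a⁻¹ ℤ.* (+ j ℤ.- b ℤ.* + y ℤ.- c)) m

  eta≡⇒%≡residue : ∀ {j x y} → eta m a b c (+ x) (+ y) ≡ j → x % m ≡ residue j y
  eta≡⇒%≡residue {j} {x} {y} refl = ≡-mod⇒%ℕ≡ (residue<m j y) (begin
    + x                                          ≡⟨ ℤP.*-identityˡ (+ x) ⟨
    ℤ.1ℤ ℤ.* + x                                 ≈⟨ *-congʳ-mod (+ x) a⁻¹a≡1 ⟨
    a⁻¹ ℤ.* a ℤ.* + x                            ≡⟨ isolate a⁻¹ a (+ x) (b ℤ.* + y) c ⟩
    a⁻¹ ℤ.* (L ℤ.- b ℤ.* + y ℤ.- c)              ≈⟨ *-congˡ-mod a⁻¹ (+-cong-mod (+-cong-mod (%ℕ-≡-mod L) refl′) refl′) ⟩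
    a⁻¹ ℤ.* (+ j ℤ.- b ℤ.* + y ℤ.- c)            ≈⟨ %ℕ-≡-mod _ ⟩
    + residue j y                                ∎)
    where
    L = a ℤ.* + x ℤ.+ b ℤ.* + y ℤ.+ c
    isolate : ∀ a⁻¹ a x u c → a⁻¹ ℤ.* a ℤ.* x ≡ a⁻¹ ℤ.* (a ℤ.* x ℤ.+ u ℤ.+ c ℤ.- u ℤ.- c)
    isolate = ℤSolver.solve-∀

  %≡residue⇒eta≡ : ∀ {j x y} → j ℕ.< m → x % m ≡ residue j y → eta m a b c (+ x) (+ y) ≡ j
  %≡residue⇒eta≡ {j} {x} {y} j<m x%m≡r = ≡-mod⇒%ℕ≡ j<m (begin
    a ℤ.* + x ℤ.+ b ℤ.* + y ℤ.+ c            ≈⟨ +-cong-mod (+-cong-mod (*-congˡ-mod a x≡a⁻¹D) refl′) refl′ ⟩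
    a ℤ.* (a⁻¹ ℤ.* D) ℤ.+ b ℤ.* + y ℤ.+ c    ≡⟨ regroup a a⁻¹ D (b ℤ.* + y) c ⟩
    a⁻¹ ℤ.* a ℤ.* D ℤ.+ (b ℤ.* + y ℤ.+ c)    ≈⟨ +-cong-mod (*-congʳ-mod D a⁻¹a≡1) refl′ ⟩
    ℤ.1ℤ ℤ.* D ℤ.+ (b ℤ.* + y ℤ.+ c)         ≡⟨ cancel (+ j) (b ℤ.* + y) c ⟩
    + j                                      ∎)
    where
    D = + j ℤ.- b ℤ.* + y ℤ.- c
    x≡a⁻¹D : + x ≡ a⁻¹ ℤ.* D mod m
    x≡a⁻¹D = begin
      + x              ≈⟨ %ℕ-≡-mod (+ x) ⟩
      + (x % m)        ≡⟨ cong +_ x%m≡r ⟩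
      + residue j y    ≈⟨ %ℕ-≡-mod (a⁻¹ ℤ.* D) ⟨
      a⁻¹ ℤ.* D        ∎
    regroup : ∀ a a⁻¹ D u c → a ℤ.* (a⁻¹ ℤ.* D) ℤ.+ u ℤ.+ c ≡ a⁻¹ ℤ.* a ℤ.* D ℤ.+ (u ℤ.+ c)
    regroup = ℤSolver.solve-∀
    cancel : ∀ j u c → ℤ.1ℤ ℤ.* (j ℤ.- u ℤ.- c) ℤ.+ (u ℤ.+ c) ≡ j
    cancel = ℤSolver.solve-∀

module _ {n : ℕ} .{{_ : NonZero n}} where

  [r+t*n]%n≡r : ∀ {r} t → r ℕ.< n → (r ℕ.+ t ℕ.* n) % n ≡ r
  [r+t*n]%n≡r {r} t r<n = trans (ℕD.[m+kn]%n≡m%n r t n) (ℕD.m<n⇒m%n≡m r<n)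

  [r+t*n]/n≡t : ∀ {r} t → r ℕ.< n → (r ℕ.+ t ℕ.* n) / n ≡ t
  [r+t*n]/n≡t {r} t r<n = begin
    (r ℕ.+ t ℕ.* n) / n     ≡⟨ ℕD.+-distrib-/-∣ʳ r (ℕd.n∣m*n t) ⟩
    r / n ℕ.+ t ℕ.* n / n   ≡⟨ cong₂ ℕ._+_ (ℕD.m<n⇒m/n≡0 r<n) (ℕD.m*n/n≡m t n) ⟩
    t                       ∎
    where open ≡-Reasoning

  r+t*n<q*n : ∀ {r t q} → r ℕ.< n → t ℕ.< q → r ℕ.+ t ℕ.* n ℕ.< q ℕ.* n
  r+t*n<q*n {t = t} r<n t<q = ℕP.<-≤-trans (ℕP.+-monoˡ-< (t ℕ.* n) r<n) (ℕP.*-monoˡ-≤ n t<q)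

  [1+m%n]%n≡[1+m]%n : ∀ m → suc (m % n) % n ≡ suc m % n
  [1+m%n]%n≡[1+m]%n m = begin
    (1 ℕ.+ m % n) % n           ≡⟨ ℕD.%-distribˡ-+ 1 (m % n) n ⟩
    (1 % n ℕ.+ m % n % n) % n   ≡⟨ cong (λ t → (1 % n ℕ.+ t) % n) (ℕD.m%n%n≡m%n m n) ⟩
    (1 % n ℕ.+ m % n) % n       ≡⟨ ℕD.%-distribˡ-+ 1 m n ⟨
    (1 ℕ.+ m) % n               ∎
    where open ≡-Reasoning

  [x+j]%n≢x : ∀ {x j} → x ℕ.< n → 0 ℕ.< j → j ℕ.< n → (x ℕ.+ j) % n ≢ x
  [x+j]%n≢x {x} {j} x<n 0<j j<n eq = ℕd.>⇒∤ {{ℕ.>-nonZero 0<j}} j<n (ℕd.divides ((x ℕ.+ j) / n) j≡q*n)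
    where
    j≡q*n : j ≡ (x ℕ.+ j) / n ℕ.* n
    j≡q*n = ℕP.+-cancelˡ-≡ x j _ (trans (ℕD.m≡m%n+[m/n]*n (x ℕ.+ j) n) (cong (ℕ._+ (x ℕ.+ j) / n ℕ.* n) eq))

  divmod-injective : ∀ {r r' t t'} → r ℕ.< n → r' ℕ.< n → r ℕ.+ t ℕ.* n ≡ r' ℕ.+ t' ℕ.* n → r ≡ r' × t ≡ t'
  divmod-injective {r} {r'} {t} {t'} r<n r'<n eq =
    trans (sym ([r+t*n]%n≡r t r<n)) (trans (cong (_% n) eq) ([r+t*n]%n≡r t' r'<n)) ,
    trans (sym ([r+t*n]/n≡t t r<n)) (trans (cong (_/ n) eq) ([r+t*n]/n≡t t' r'<n))

record GridEnumeration (A B K : ℕ) (Q : ℤ → ℤ → Set) : Set where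
  field
    point      : Fin K → ℕ × ℕ
    injective  : ∀ {i j} → point i ≡ point j → i ≡ j
    bounded    : ∀ i → proj₁ (point i) ℕ.< A × proj₂ (point i) ℕ.< B
    satisfies  : ∀ i → Q (+ proj₁ (point i)) (+ proj₂ (point i))
    exhaustive : ∀ {x y} → x ℕ.< A → y ℕ.< B → Q (+ x) (+ y) → ∃[ i ] (point i ≡ (x , y))

rowwise-enumeration : ∀ {A B Q} q (x : ℕ → ℕ → ℕ) →
  (∀ {t t' y} → x t y ≡ x t' y → t ≡ t') →
  (∀ {t y} → t ℕ.< q → y ℕ.< B → x t y ℕ.< A × Q (+ x t y) (+ y)) →
  (∀ {x' y} → x' ℕ.< A → y ℕ.< B → Q (+ x') (+ y) → ∃[ t ] (t ℕ.< q × x t y ≡ x')) →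
  GridEnumeration A B (q ℕ.* B) Q
rowwise-enumeration {A} {B} {Q} q x x-injective x-valid x-onto = record
  { point      = point
  ; injective  = injective
  ; bounded    = λ i → proj₁ (valid i) , FinP.toℕ<n (row i)
  ; satisfies  = λ i → proj₂ (valid i)
  ; exhaustive = exhaustive
  }
  where
  column : Fin (q ℕ.* B) → Fin q
  column i = proj₁ (Fin.remQuot {q} B i)
  row : Fin (q ℕ.* B) → Fin B
  row i = proj₂ (Fin.remQuot {q} B i)

  point : Fin (q ℕ.* B) → ℕ × ℕ
  point i = x (toℕ (column i)) (toℕ (row i)) , toℕ (row i)

  valid : ∀ i → x (toℕ (column i)) (toℕ (row i)) ℕ.< A × Q (+ x (toℕ (column i)) (toℕ (row i))) (+ toℕ (row i))
  valid i = x-valid (FinP.toℕ<n (column i)) (FinP.toℕ<n (row i))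

  injective : ∀ {i j} → point i ≡ point j → i ≡ j
  injective {i} {j} eq = begin
    i                                    ≡⟨ FinP.combine-remQuot {q} B i ⟨
    Fin.combine (column i) (row i)       ≡⟨ cong₂ Fin.combine same-column same-row ⟩
    Fin.combine (column j) (row j)       ≡⟨ FinP.combine-remQuot {q} B j ⟩
    j                                    ∎
    where
    open ≡-Reasoning
    same-row′ : toℕ (row i) ≡ toℕ (row j)
    same-row′ = cong proj₂ eq
    same-row : row i ≡ row j
    same-row = FinP.toℕ-injective same-row′
    same-column : column i ≡ column j
    same-column = FinP.toℕ-injective (x-injective (trans (cong proj₁ eq) (cong (x (toℕ (column j))) (sym same-row′))))

  exhaustive : ∀ {x' y} → x' ℕ.< A → y ℕ.< B → Q (+ x') (+ y) → ∃[ i ] (point i ≡ (x' , y))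
  exhaustive {x'} {y} x'<A y<B q with x-onto x'<A y<B q
  ... | t , t<q , refl = Fin.combine (fromℕ< t<q) (fromℕ< y<B) , (begin
    point (Fin.combine (fromℕ< t<q) (fromℕ< y<B))                 ≡⟨ cong (λ (c , r) → x (toℕ c) (toℕ r) , toℕ r)
                                                                        (FinP.remQuot-combine (fromℕ< t<q) (fromℕ< y<B)) ⟩
    x (toℕ (fromℕ< t<q)) (toℕ (fromℕ< y<B)) , toℕ (fromℕ< y<B)   ≡⟨ cong₂ (λ c r → x c r , r) (FinP.toℕ-fromℕ< t<q) (FinP.toℕ-fromℕ< y<B) ⟩
    x t y , y                                                     ∎)
    where open ≡-Reasoning

rectangle-enumeration : ∀ A B → GridEnumeration A B (A ℕ.* B) (λ _ _ → ⊤)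
rectangle-enumeration A B =
  rowwise-enumeration A (λ t _ → t) (λ eq → eq) (λ t<A _ → t<A , tt) (λ {x'} x'<A _ _ → x' , x'<A , refl)

colour-class-enumeration : ∀ m .{{_ : NonZero m}} {a b c} → gcd a (+ m) ≡ + 1 →
  ∀ q B {j} → j ℕ.< m → GridEnumeration (q ℕ.* m) B (q ℕ.* B) (λ x y → eta m a b c x y ≡ j)
colour-class-enumeration m {a} {b} {c} coprime q B {j} j<m =
  rowwise-enumeration q (λ t y → residue j y ℕ.+ t ℕ.* m) injective valid onto
  where
  open LinearColouring m a b c coprime

  injective : ∀ {t t' y} → residue j y ℕ.+ t ℕ.* m ≡ residue j y ℕ.+ t' ℕ.* m → t ≡ t'
  injective {t} {t'} {y} eq = ℕP.*-cancelʳ-≡ t t' m (ℕP.+-cancelˡ-≡ (residue j y) _ _ eq)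

  valid : ∀ {t y} → t ℕ.< q → y ℕ.< B →
          residue j y ℕ.+ t ℕ.* m ℕ.< q ℕ.* m × eta m a b c (+ (residue j y ℕ.+ t ℕ.* m)) (+ y) ≡ j
  valid {t} {y} t<q _ = r+t*n<q*n (residue<m j y) t<q , %≡residue⇒eta≡ j<m ([r+t*n]%n≡r t (residue<m j y))

  onto : ∀ {x y} → x ℕ.< q ℕ.* m → y ℕ.< B → eta m a b c (+ x) (+ y) ≡ j →
         ∃[ t ] (t ℕ.< q × residue j y ℕ.+ t ℕ.* m ≡ x)
  onto {x} x<qm _ coloured = x / m , ℕD.m<n*o⇒m/o<n x<qm ,
    trans (cong (ℕ._+ x / m ℕ.* m) (sym (eta≡⇒%≡residue coloured))) (sym (ℕD.m≡m%n+[m/n]*n x m))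

HasCard-cong : ∀ {S S' : V3 → Set} {N} → (∀ l → S l → S' l) → (∀ l → S' l → S l) → HasCard S N → HasCard S' N
HasCard-cong to from (f , f∈S , f-injective , f-onto) = f , (λ i → to (f i) (f∈S i)) , f-injective , (λ l s → f-onto l (from l s))

HasCard-unique : ∀ {S : V3 → Set} {N M} → HasCard S N → HasCard S M → N ≡ M
HasCard-unique {S} {N} {M} (f , f∈S , f-injective , f-onto) (g , g∈S , g-injective , g-onto) =
  ℕP.≤-antisym (FinP.injective⇒≤ (g⁻¹∘f-injective f g f∈S g-onto f-injective))
               (FinP.injective⇒≤ (g⁻¹∘f-injective g f g∈S f-onto g-injective))
  where
  g⁻¹∘f-injective : ∀ {K L} (f : Fin K → V3) (g : Fin L → V3) (f∈S : ∀ i → S (f i)) →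
    (g-onto : ∀ x → S x → ∃[ i ] (g i ≡ x)) → (∀ i j → f i ≡ f j → i ≡ j) →
    ∀ {i j} → proj₁ (g-onto (f i) (f∈S i)) ≡ proj₁ (g-onto (f j) (f∈S j)) → i ≡ j
  g⁻¹∘f-injective f g f∈S g-onto f-injective {i} {j} eq = f-injective i j (begin
    f i                              ≡⟨ proj₂ (g-onto (f i) (f∈S i)) ⟨
    g (proj₁ (g-onto (f i) (f∈S i))) ≡⟨ cong g eq ⟩
    g (proj₁ (g-onto (f j) (f∈S j))) ≡⟨ proj₂ (g-onto (f j) (f∈S j)) ⟩
    f j                              ∎)
    where open ≡-Reasoning

HasCard-empty : ∀ {S : V3 → Set} → (∀ l → ¬ S l) → HasCard S 0
HasCard-empty empty = (λ ()) , (λ ()) , (λ ()) , (λ l s → contradiction s (empty l))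

ℕ⇒InR : ∀ {A B x y} → x ℕ.< A → y ℕ.< B → InR (+ A) (+ B) (+ x) (+ y)
ℕ⇒InR (s≤s x≤A-1) (s≤s y≤B-1) = +≤+ z≤n , +≤+ x≤A-1 , +≤+ z≤n , +≤+ y≤B-1

InR⇒ℕ : ∀ {A B x y} → InR (+ A) (+ B) x y → ∃[ x' ] ∃[ y' ] (x ≡ + x' × y ≡ + y' × x' ℕ.< A × y' ℕ.< B)
InR⇒ℕ {suc _} {suc _} {+ x} {+ y} (_ , +≤+ x≤A-1 , _ , +≤+ y≤B-1) = x , y , refl , refl , s≤s x≤A-1 , s≤s y≤B-1

Coloured : (m : ℕ) .{{_ : NonZero m}} → (V3 → ℤ → ℤ → Set) → ℤ → ℤ → ℤ → V3 → ℕ → Set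
Coloured m G a b c l j = ∃[ x ] ∃[ y ] (G l x y × eta m a b c x y ≡ j)

Equidistributed : (m : ℕ) .{{_ : NonZero m}} → (V3 → Set) → (V3 → ℕ → Set) → Set
Equidistributed m S C =
  ∀ N → HasCard S N → (m ℕd.∣ N) × (∀ j → j ℕ.< m → HasCard (λ l → S l × C l j) (N ℕ./ m))

iter-comm : ∀ σ k (l : V3) → iter σ k (σ l) ≡ σ (iter σ k l)
iter-comm σ zero    l = refl
iter-comm σ (suc k) l = cong σ (iter-comm σ k l)

Rotates₁ : (V3 → Set) → (V3 → ℤ → ℤ → Set) → ℤ → (V3 → V3) → Set
Rotates₁ P G L σ =
  ∀ l → P l → ∀ x y → G l x y → ∀ x' → ℤ.0ℤ ℤ.≤ x' → x' ℤ.≤ L ℤ.- ℤ.1ℤ →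
    L ℤd.∣ (x ℤ.+ ℤ.1ℤ ℤ.- x') → G (σ l) x' y

Rotates₂ : (V3 → Set) → (V3 → ℤ → ℤ → Set) → ℤ → (V3 → V3) → Set
Rotates₂ P G L σ =
  ∀ l → P l → ∀ x y → G l x y → ∀ y' → ℤ.0ℤ ℤ.≤ y' → y' ℤ.≤ L ℤ.- ℤ.1ℤ →
    L ℤd.∣ (y ℤ.+ ℤ.1ℤ ℤ.- y') → G (σ l) x y'

record Chart (P : V3 → Set) (G : V3 → ℤ → ℤ → Set) (L₁ L₂ : ℤ) : Set where
  field
    total      : ∀ {l} → P l → ∃[ x ] ∃[ y ] G l x y
    within     : ∀ {l x y} → P l → G l x y → InR L₁ L₂ x y
    functional : ∀ {l x y x' y'} → P l → G l x y → G l x' y' → x ≡ x' × y ≡ y'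
    surjective : ∀ {x y} → InR L₁ L₂ x y → ∃[ l ] (P l × G l x y)
    injective  : ∀ {l l' x y} → P l → P l' → G l x y → G l' x y → l ≡ l'

module NaturalChart {P G} {A B : ℕ} (chart : Chart P G (+ A) (+ B)) where
  open Chart chart

  coordinates : ∀ {l} → P l → ∃[ x ] ∃[ y ] (G l (+ x) (+ y) × x ℕ.< A × y ℕ.< B)
  coordinates p with total p
  ... | x , y , g with InR⇒ℕ {A} {B} (within p g)
  ... | x' , y' , refl , refl , x'<A , y'<B = x' , y' , g , x'<A , y'<B

  pointAt : ∀ {x y} → x ℕ.< A → y ℕ.< B → ∃[ l ] (P l × G l (+ x) (+ y))
  pointAt x<A y<B = surjective (ℕ⇒InR {A} {B} x<A y<B)

  count : ∀ {K Q} → GridEnumeration A B K Q → HasCard (λ l → P l × ∃[ x ] ∃[ y ] (G l x y × Q x y)) K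
  count {K} {Q} enumeration = f , f∈S , f-injective , f-onto
    where
    open GridEnumeration enumeration renaming (injective to point-injective)

    at : ∀ i → ∃[ l ] (P l × G l (+ proj₁ (point i)) (+ proj₂ (point i)))
    at i = pointAt (proj₁ (bounded i)) (proj₂ (bounded i))

    f : Fin K → V3
    f i = proj₁ (at i)

    f∈S : ∀ i → P (f i) × ∃[ x ] ∃[ y ] (G (f i) x y × Q x y)
    f∈S i = proj₁ (proj₂ (at i)) , _ , _ , proj₂ (proj₂ (at i)) , satisfies i

    f-injective : ∀ i j → f i ≡ f j → i ≡ j
    f-injective i j eq with functional (proj₁ (proj₂ (at i))) (proj₂ (proj₂ (at i)))
                                       (subst (λ l → G l _ _) (sym eq) (proj₂ (proj₂ (at j))))
    ... | same-x , same-y = point-injective (cong₂ _,_ (ℤP.+-injective same-x) (ℤP.+-injective same-y))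

    f-onto : ∀ l → P l × ∃[ x ] ∃[ y ] (G l x y × Q x y) → ∃[ i ] (f i ≡ l)
    f-onto l (p , x , y , g , q) with InR⇒ℕ {A} {B} (within p g)
    ... | x' , y' , refl , refl , x'<A , y'<B with exhaustive x'<A y'<B q
    ... | i , point-i = i , injective (proj₁ (proj₂ (at i))) p
                              (subst (λ (u , v) → G (f i) (+ u) (+ v)) point-i (proj₂ (proj₂ (at i)))) g

  cardinality : ∀ {N} → HasCard P N → N ≡ A ℕ.* B
  cardinality P-card = HasCard-unique P-card
    (HasCard-cong (λ l → proj₁) (λ l p → p , proj₁ (total p) , proj₁ (proj₂ (total p)) , proj₂ (proj₂ (total p)) , tt)
      (count (rectangle-enumeration A B)))

  equidistributed : ∀ m .{{_ : NonZero m}} {a b c q} → gcd a (+ m) ≡ + 1 → A ≡ q ℕ.* m →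
                    Equidistributed m P (Coloured m G a b c)
  equidistributed m {a} {b} {c} {q} coprime A≡qm N P-card =
    ℕd.divides (q ℕ.* B) N≡qB*m , λ j j<m →
      subst (HasCard _) (sym N/m≡qB)
        (count (subst (λ A′ → GridEnumeration A′ B (q ℕ.* B) _) (sym A≡qm)
                      (colour-class-enumeration m {a} {b} {c} coprime q B j<m)))
    where
    N≡qB*m : N ≡ q ℕ.* B ℕ.* m
    N≡qB*m = trans (cardinality P-card) (trans (cong (ℕ._* B) A≡qm) (swap q m B))
      where
      swap : ∀ q m B → q ℕ.* m ℕ.* B ≡ q ℕ.* B ℕ.* m
      swap = ℕSolver.solve-∀
    N/m≡qB : N ℕ./ m ≡ q ℕ.* B
    N/m≡qB = trans (ℕD./-congˡ N≡qB*m) (ℕD.m*n/n≡m (q ℕ.* B) m)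

  module Rotation (P? : ∀ l → Dec (P l)) .{{_ : NonZero A}} where

    private
      step : ∀ {l} → P l → V3
      step p with coordinates p
      ... | x , y , _ , _ , y<B = proj₁ (pointAt (ℕD.m%n<n (suc x) A) y<B)

      step-coordinates : ∀ {l x y} (p : P l) → G l (+ x) (+ y) → P (step p) × G (step p) (+ (suc x % A)) (+ y)
      step-coordinates p g with coordinates p
      ... | x₀ , y₀ , g₀ , _ , y₀<B with functional p g g₀
      ... | refl , refl = proj₂ (pointAt (ℕD.m%n<n (suc x₀) A) y₀<B)

    -- Off P, σ is the identity: only its restriction to P is ever used.
    σ : V3 → V3
    σ l with P? l
    ... | yes p = step p
    ... | no _  = l

    σ-coordinates : ∀ {l x y} → P l → G l (+ x) (+ y) → P (σ l) × G (σ l) (+ (suc x % A)) (+ y)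
    σ-coordinates {l} p g with P? l
    ... | yes p′ = step-coordinates p′ g
    ... | no ¬p  = contradiction p ¬p

    iter-coordinates : ∀ {l x y} → P l → G l (+ x) (+ y) → x ℕ.< A →
                       ∀ j → P (iter σ j l) × G (iter σ j l) (+ ((x ℕ.+ j) % A)) (+ y)
    iter-coordinates {l} {x} {y} p g x<A zero =
      p , subst (λ u → G l (+ u) (+ y)) (sym (trans (cong (_% A) (ℕP.+-identityʳ x)) (ℕD.m<n⇒m%n≡m x<A))) g
    iter-coordinates {l} {x} {y} p g x<A (suc j) with iter-coordinates p g x<A j
    ... | pⱼ , gⱼ with σ-coordinates pⱼ gⱼ
    ... | pⱼ₊₁ , gⱼ₊₁ = pⱼ₊₁ , subst (λ u → G (iter σ (suc j) l) (+ u) (+ y))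
                                     (trans ([1+m%n]%n≡[1+m]%n (x ℕ.+ j)) (cong (_% A) (sym (ℕP.+-suc x j)))) gⱼ₊₁

    iter-preserves : ∀ j {l} → P l → P (iter σ j l)
    iter-preserves j p with coordinates p
    ... | _ , _ , g , x<A , _ = proj₁ (iter-coordinates p g x<A j)

    period : ∀ l → P l → iter σ A l ≡ l
    period l p with coordinates p
    ... | x , y , g , x<A , _ with iter-coordinates p g x<A A
    ... | p₀ , g₀ = injective p₀ p (subst (λ u → G (iter σ A l) (+ u) (+ y)) [x+A]%A≡x g₀) g
      where
      [x+A]%A≡x : (x ℕ.+ A) % A ≡ x
      [x+A]%A≡x = trans (ℕD.[m+n]%n≡m%n x A) (ℕD.m<n⇒m%n≡m x<A)

    no-shorter-period : ∀ l → P l → ∀ j → 0 ℕ.< j → j ℕ.< A → ¬ (iter σ j l ≡ l)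
    no-shorter-period l p j 0<j j<A eq with coordinates p
    ... | x , y , g , x<A , _ with iter-coordinates p g x<A j
    ... | _ , gⱼ = [x+j]%n≢x x<A 0<j j<A (ℤP.+-injective (proj₁ (functional p (subst (λ l′ → G l′ _ _) eq gⱼ) g)))

    ρ : V3 → V3
    ρ = iter σ (ℕ.pred A)

    σ∘ρ : ∀ l → P l → σ (ρ l) ≡ l
    σ∘ρ l p = trans (cong (λ k → iter σ k l) (ℕP.suc-pred A)) (period l p)

    ρ∘σ : ∀ l → P l → ρ (σ l) ≡ l
    ρ∘σ l p = trans (iter-comm σ (ℕ.pred A) l) (σ∘ρ l p)

    cycles : PermCycles P σ A
    cycles = (λ l → iter-preserves 1) , (ρ , (λ l → iter-preserves (ℕ.pred A)) , ρ∘σ , σ∘ρ) , period , no-shorter-period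

    rotates : Rotates₁ P G (+ A) σ
    rotates l p x y g x' 0≤x' x'≤A-1 A∣x+1-x' with within p g
    ... | _ , _ , y-bounds with InR⇒ℕ {A} {B} (within p g) | InR⇒ℕ {A} {B} (0≤x' , x'≤A-1 , y-bounds)
    ... | x₀ , y₀ , refl , refl , _ , _ | x₁ , _ , refl , _ , x₁<A , _ =
      subst (λ u → G (σ l) (+ u) (+ y₀)) [1+x₀]%A≡x₁ (proj₂ (σ-coordinates p g))
      where
      [1+x₀]%A≡x₁ : suc x₀ % A ≡ x₁
      [1+x₀]%A≡x₁ = ≡-mod⇒%ℕ≡ {z = + suc x₀} x₁<A (congruence
        (subst (λ t → + A ℤs.∣ t ℤ.- + x₁) (cong +_ (ℕP.+-comm x₀ 1)) (ℤs.∣ᵤ⇒∣ A∣x+1-x')))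

Conclusion₁ Conclusion₂ : (m : ℕ) .{{_ : NonZero m}} → (V3 → Set) → (V3 → ℤ → ℤ → Set) → ℤ → ℤ → ℤ → ℤ → Set
Conclusion₁ m P G L a b c =
  Equidistributed m P (Coloured m G a b c) × Σ (V3 → V3) λ σ → PermCycles P σ ∣ L ∣ × Rotates₁ P G L σ
Conclusion₂ m P G L a b c =
  Equidistributed m P (Coloured m G a b c) × Σ (V3 → V3) λ σ → PermCycles P σ ∣ L ∣ × Rotates₂ P G L σ

empty-conclusion : ∀ {m} .{{_ : NonZero m}} {P G L a b c} → (∀ l → ¬ P l) → Conclusion₁ m P G L a b c
empty-conclusion {m} {P} empty =
  (λ N P-card → subst (λ N → m ℕd.∣ N × (∀ j → j ℕ.< m → HasCard _ (N ℕ./ m)))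
                      (sym (HasCard-unique P-card (HasCard-empty empty)))
                      (m ℕd.∣0 , λ j _ → subst (HasCard _) (sym (ℕD.0/n≡0 m)) (HasCard-empty (λ l s → empty l (proj₁ s))))) ,
  (λ l → l) , ((absurd , ((λ l → l) , absurd , absurd , absurd) , absurd , absurd) , absurd)
  where
  absurd : ∀ {A : V3 → Set} l → P l → A l
  absurd l p = contradiction p (empty l)

interval-empty : ∀ {L x} → L ℤ.≤ ℤ.0ℤ → ℤ.0ℤ ℤ.≤ x → ¬ (x ℤ.≤ L ℤ.- ℤ.1ℤ)
interval-empty L≤0 0≤x x≤L-1 with ℤP.≤-trans (ℤP.≤-trans 0≤x x≤L-1) (ℤP.+-monoˡ-≤ ℤ.-1ℤ L≤0)
... | ()

Chart-empty : ∀ {P G L₁ L₂} → Chart P G L₁ L₂ → (∀ {x y} → ¬ InR L₁ L₂ x y) → ∀ l → ¬ P l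
Chart-empty chart R-empty l p = R-empty (within p (proj₂ (proj₂ (total p))))
  where open Chart chart

chart-conclusion : ∀ {m} .{{_ : NonZero m}} {P G L₁ L₂ a b c} → (∀ l → Dec (P l)) → Chart P G L₁ L₂ →
                   gcd a (+ m) ≡ + 1 → + m ℤd.∣ L₁ → Conclusion₁ m P G L₁ a b c
chart-conclusion {m} {L₁ = + suc A} {+ B} {a} {b} {c} P? chart coprime (ℕd.divides q A≡qm) =
  equidistributed m {a} {b} {c} {q} coprime A≡qm , σ , cycles , rotates
  where
  open NaturalChart chart
  open Rotation P?
chart-conclusion {L₁ = L₁@(+ zero)} {a = a} {b} {c} P? chart _ _ =
  empty-conclusion {L = L₁} {a} {b} {c} (Chart-empty chart λ (0≤x , x≤L₁-1 , _) → interval-empty (+≤+ z≤n) 0≤x x≤L₁-1)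
chart-conclusion {L₁ = L₁@(-[1+ _ ])} {a = a} {b} {c} P? chart _ _ =
  empty-conclusion {L = L₁} {a} {b} {c} (Chart-empty chart λ (0≤x , x≤L₁-1 , _) → interval-empty ℤ.-≤+ 0≤x x≤L₁-1)
chart-conclusion {L₁ = L₁@(+ suc _)} {L₂ = -[1+ _ ]} {a = a} {b} {c} P? chart _ _ =
  empty-conclusion {L = L₁} {a} {b} {c} (Chart-empty chart λ (_ , _ , 0≤y , y≤L₂-1) → interval-empty ℤ.-≤+ 0≤y y≤L₂-1)

transpose : ∀ {P G L₁ L₂} → Chart P G L₁ L₂ → Chart P (λ l y x → G l x y) L₂ L₁
transpose chart = record
  { total      = λ p → let (x , y , g) = total p in y , x , g
  ; within     = λ p g → let (0≤x , x≤L₁-1 , 0≤y , y≤L₂-1) = within p g in 0≤y , y≤L₂-1 , 0≤x , x≤L₁-1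
  ; functional = λ p g g′ → let (x≡x′ , y≡y′) = functional p g g′ in y≡y′ , x≡x′
  ; surjective = λ (0≤y , y≤L₂-1 , 0≤x , x≤L₁-1) → surjective (0≤x , x≤L₁-1 , 0≤y , y≤L₂-1)
  ; injective  = injective
  }
  where open Chart chart

transposed-conclusion : ∀ {m} .{{_ : NonZero m}} {P G L₁ L₂ a b c} → (∀ l → Dec (P l)) → Chart P G L₁ L₂ →
                        gcd b (+ m) ≡ + 1 → + m ℤd.∣ L₂ → Conclusion₂ m P G L₂ a b c
transposed-conclusion {m} {P} {G} {a = a} {b} {c} P? chart coprime m∣L₂
  with chart-conclusion {a = b} {a} {c} P? (transpose chart) coprime m∣L₂
... | equidistributed , σ , cycles , rotates =
  (λ N P-card → let (m∣N , classes) = equidistributed N P-card in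
    m∣N , λ j j<m → HasCard-cong (λ l (p , y , x , g , coloured) → p , x , y , g , trans (eta-swap x y) coloured)
                                 (λ l (p , x , y , g , coloured) → p , y , x , g , trans (sym (eta-swap x y)) coloured)
                                 (classes j j<m)) ,
  σ , cycles , λ l p x y g → rotates l p y x g
  where
  eta-swap : ∀ x y → eta m a b c x y ≡ eta m b a c y x
  eta-swap x y = cong (λ t → (t ℤ.+ c) %ℕ m) (ℤP.+-comm (a ℤ.* x) (b ℤ.* y))

toℚ≡mkℚ : ∀ z → toℚ z ≡ mkℚ z 0 (ℕC.sym (ℕC.1-coprimeTo ∣ z ∣))
toℚ≡mkℚ z = ℚP.↥p/↧p≡p (mkℚ z 0 (ℕC.sym (ℕC.1-coprimeTo ∣ z ∣)))

toℚ-injective : ∀ {x y} → toℚ x ≡ toℚ y → x ≡ y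
toℚ-injective {x} {y} eq = cong ℚ.↥_ (trans (sym (toℚ≡mkℚ x)) (trans eq (toℚ≡mkℚ y)))

toℚ-cancel-≤ : ∀ {x y} → toℚ x ℚ.≤ toℚ y → x ℤ.≤ y
toℚ-cancel-≤ {x} {y} x≤y rewrite toℚ≡mkℚ x | toℚ≡mkℚ y with x≤y
... | ℚ.*≤* x*1≤y*1 = subst₂ ℤ._≤_ (ℤP.*-identityʳ x) (ℤP.*-identityʳ y) x*1≤y*1

toℚ-cancel-< : ∀ {x y} → toℚ x ℚ.< toℚ y → x ℤ.< y
toℚ-cancel-< {x} {y} x<y rewrite toℚ≡mkℚ x | toℚ≡mkℚ y with x<y
... | ℚ.*<* x*1<y*1 = subst₂ ℤ._<_ (ℤP.*-identityʳ x) (ℤP.*-identityʳ y) x*1<y*1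

toℚ-+ : ∀ x y → toℚ x ℚ.+ toℚ y ≡ toℚ (x ℤ.+ y)
toℚ-+ x y rewrite toℚ≡mkℚ x | toℚ≡mkℚ y =
  cong (ℚ._/ 1) (cong₂ ℤ._+_ (ℤP.*-identityʳ x) (ℤP.*-identityʳ y))

pt-injective : ∀ {x y x' y'} → pt x y ≡ pt x' y' → x ≡ x' × y ≡ y'
pt-injective eq = toℚ-injective (cong proj₁ eq) , toℚ-injective (cong proj₂ eq)

module _ (k : ℤ) .{{_ : ℚ.Positive (toℚ k)}} where

  private
    instance
      k-nonNegative : ℚ.NonNegative (toℚ k)
      k-nonNegative = ℚP.pos⇒nonNeg (toℚ k)

  open ℚP.≤-Reasoning

  scaled-fraction-bounds : ∀ {z w q} → ℚ.0ℚ ℚ.≤ q → q ℚ.< ℚ.1ℚ →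
                           toℚ z ≡ toℚ k ℚ.* q ℚ.+ toℚ w → w ℤ.≤ z × z ℤ.< k ℤ.+ w
  scaled-fraction-bounds {z} {w} {q} 0≤q q<1 eq = toℚ-cancel-≤ w≤z , toℚ-cancel-< z<k+w
    where
    w≤z : toℚ w ℚ.≤ toℚ z
    w≤z = begin
      toℚ w                         ≡⟨ ℚP.+-identityˡ (toℚ w) ⟨
      ℚ.0ℚ ℚ.+ toℚ w                ≡⟨ cong (ℚ._+ toℚ w) (ℚP.*-zeroʳ (toℚ k)) ⟨
      toℚ k ℚ.* ℚ.0ℚ ℚ.+ toℚ w      ≤⟨ ℚP.+-monoˡ-≤ (toℚ w) (ℚP.*-monoˡ-≤-nonNeg (toℚ k) 0≤q) ⟩
      toℚ k ℚ.* q ℚ.+ toℚ w         ≡⟨ eq ⟨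
      toℚ z                         ∎
    z<k+w : toℚ z ℚ.< toℚ (k ℤ.+ w)
    z<k+w = begin-strict
      toℚ z                         ≡⟨ eq ⟩
      toℚ k ℚ.* q ℚ.+ toℚ w         <⟨ ℚP.+-monoˡ-< (toℚ w) (ℚP.*-monoʳ-<-pos (toℚ k) q<1) ⟩
      toℚ k ℚ.* ℚ.1ℚ ℚ.+ toℚ w      ≡⟨ cong (ℚ._+ toℚ w) (ℚP.*-identityʳ (toℚ k)) ⟩
      toℚ k ℚ.+ toℚ w               ≡⟨ toℚ-+ k w ⟩
      toℚ (k ℤ.+ w)                 ∎

  scaled-fraction-bounds′ : ∀ {z q} → ℚ.0ℚ ℚ.< q → q ℚ.≤ ℚ.1ℚ → toℚ z ≡ toℚ k ℚ.* q → ℤ.0ℤ ℤ.< z × z ℤ.≤ k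
  scaled-fraction-bounds′ {z} {q} 0<q q≤1 eq = toℚ-cancel-< 0<z , toℚ-cancel-≤ z≤k
    where
    0<z : toℚ ℤ.0ℤ ℚ.< toℚ z
    0<z = begin-strict
      ℚ.0ℚ              ≡⟨ ℚP.*-zeroʳ (toℚ k) ⟨
      toℚ k ℚ.* ℚ.0ℚ    <⟨ ℚP.*-monoʳ-<-pos (toℚ k) 0<q ⟩
      toℚ k ℚ.* q       ≡⟨ eq ⟨
      toℚ z             ∎
    z≤k : toℚ z ℚ.≤ toℚ k
    z≤k = begin
      toℚ z             ≡⟨ eq ⟩
      toℚ k ℚ.* q       ≤⟨ ℚP.*-monoˡ-≤-nonNeg (toℚ k) q≤1 ⟩
      toℚ k ℚ.* ℚ.1ℚ    ≡⟨ ℚP.*-identityʳ (toℚ k) ⟩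
      toℚ k             ∎

-- partition a₁ a₂ a₃ is the λ ∈ ℤ³ with λ₃ = a₃ + 1, λ₂ − λ₃ = a₂ and λ₁ − λ₂ = a₁.
partition : ℕ → ℕ → ℕ → V3
partition a₁ a₂ a₃ = (+ (suc a₃ ℕ.+ a₂ ℕ.+ a₁) , + (suc a₃ ℕ.+ a₂) , + suc a₃)

partition-cong : ∀ {a₁ a₂ a₃ b₁ b₂ b₃} → a₁ ≡ b₁ → a₂ ≡ b₂ → a₃ ≡ b₃ → partition a₁ a₂ a₃ ≡ partition b₁ b₂ b₃
partition-cong refl refl refl = refl

partition-injective : ∀ {a₁ a₂ a₃ b₁ b₂ b₃} → partition a₁ a₂ a₃ ≡ partition b₁ b₂ b₃ →
                      a₁ ≡ b₁ × a₂ ≡ b₂ × a₃ ≡ b₃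
partition-injective {a₁} {a₂} {a₃} eq with ℕP.suc-injective (ℤP.+-injective (cong (λ l → proj₂ (proj₂ l)) eq))
... | refl with ℕP.+-cancelˡ-≡ (suc a₃) a₂ _ (ℤP.+-injective (cong (λ l → proj₁ (proj₂ l)) eq))
... | refl = ℕP.+-cancelˡ-≡ (suc a₃ ℕ.+ a₂) a₁ _ (ℤP.+-injective (cong proj₁ eq)) , refl , refl

≤⇒offset : ∀ {a v} → + a ℤ.≤ v → ∃[ d ] (v ≡ + (a ℕ.+ d))
≤⇒offset {a} {+ n} (+≤+ a≤n) = n ℕ.∸ a , cong +_ (sym (ℕP.m+[n∸m]≡n a≤n))

bounded-offset : ∀ {a v k} → + a ℤ.≤ v → v ℤ.< + k ℤ.+ + a → ∃[ d ] (v ≡ + (a ℕ.+ d) × d ℕ.< k)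
bounded-offset {a} {k = k} a≤v v<k+a with ≤⇒offset a≤v
... | d , refl = d , refl , ℕP.+-cancelˡ-< a d k (subst (a ℕ.+ d ℕ.<_) (ℕP.+-comm k a) (ℤP.drop‿+<+ v<k+a))

InP⇒partition : ∀ {n l} → InP n l → ∃[ a₁ ] ∃[ a₂ ] ∃[ a₃ ] (l ≡ partition a₁ a₂ a₃)
InP⇒partition {l = _ , _ , + suc a₃} (_ , l₂≤l₁ , l₃≤l₂ , +<+ _) with ≤⇒offset l₃≤l₂
... | a₂ , refl with ≤⇒offset l₂≤l₁
... | a₁ , refl = a₁ , a₂ , a₃ , refl

partition-InP : ∀ {n} a₁ a₂ a₃ → sum3 (partition a₁ a₂ a₃) ≡ n → InP n (partition a₁ a₂ a₃)
partition-InP a₁ a₂ a₃ sum≡n =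
  sum≡n , +≤+ (ℕP.m≤m+n (suc a₃ ℕ.+ a₂) a₁) , +≤+ (ℕP.m≤m+n (suc a₃) a₂) , +<+ (s≤s z≤n)

NonNeg⇒ℕ³ : ∀ {τ} → NonNeg τ → ∃[ t₁ ] ∃[ t₂ ] ∃[ t₃ ] (τ ≡ (+ t₁ , + t₂ , + t₃))
NonNeg⇒ℕ³ {+ t₁ , + t₂ , + t₃} _ = t₁ , t₂ , t₃ , refl

partition-+V-V3mul : ∀ a₁ a₂ a₃ t₁ t₂ t₃ → partition a₁ a₂ a₃ +V V3mul (+ t₁ , + t₂ , + t₃) ≡
                     partition (a₁ ℕ.+ t₁ ℕ.* 6) (a₂ ℕ.+ t₂ ℕ.* 3) (a₃ ℕ.+ t₃ ℕ.* 2)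
partition-+V-V3mul a₁ a₂ a₃ t₁ t₂ t₃
  rewrite sym (ℤP.pos-* 6 t₁) | sym (ℤP.pos-* 3 t₂) | sym (ℤP.pos-* 2 t₃) =
  cong₂ _,_ (cong +_ (first a₁ a₂ a₃ t₁ t₂ t₃)) (cong₂ _,_ (cong +_ (second a₂ a₃ t₂ t₃)) (cong +_ (third a₃ t₃)))
  where
  first : ∀ a₁ a₂ a₃ t₁ t₂ t₃ → suc a₃ ℕ.+ a₂ ℕ.+ a₁ ℕ.+ (6 ℕ.* t₁ ℕ.+ 3 ℕ.* t₂ ℕ.+ 2 ℕ.* t₃) ≡
          suc (a₃ ℕ.+ t₃ ℕ.* 2) ℕ.+ (a₂ ℕ.+ t₂ ℕ.* 3) ℕ.+ (a₁ ℕ.+ t₁ ℕ.* 6)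
  first = ℕSolver.solve-∀
  second : ∀ a₂ a₃ t₂ t₃ → suc a₃ ℕ.+ a₂ ℕ.+ (3 ℕ.* t₂ ℕ.+ 2 ℕ.* t₃) ≡ suc (a₃ ℕ.+ t₃ ℕ.* 2) ℕ.+ (a₂ ℕ.+ t₂ ℕ.* 3)
  second = ℕSolver.solve-∀
  third : ∀ a₃ t₃ → suc a₃ ℕ.+ 2 ℕ.* t₃ ≡ suc (a₃ ℕ.+ t₃ ℕ.* 2)
  third = ℕSolver.solve-∀

-- The body of InF3, so that InF3 μ is ∃ a b c (F3Coefficients μ a b c) by definition.
F3Coefficients : V3 → ℚ → ℚ → ℚ → Set
F3Coefficients (μ₁ , μ₂ , μ₃) a b c =
  (ℚ.0ℚ ℚ.≤ a) × (a ℚ.< ℚ.1ℚ) × (ℚ.0ℚ ℚ.≤ b) × (b ℚ.< ℚ.1ℚ) × (ℚ.0ℚ ℚ.< c) × (c ℚ.≤ ℚ.1ℚ) ×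
  (toℚ μ₁ ≡ toℚ (+ 6) ℚ.* a ℚ.+ toℚ (+ 3) ℚ.* b ℚ.+ toℚ (+ 2) ℚ.* c) ×
  (toℚ μ₂ ≡ toℚ (+ 3) ℚ.* b ℚ.+ toℚ (+ 2) ℚ.* c) ×
  (toℚ μ₃ ≡ toℚ (+ 2) ℚ.* c)

F3Coefficients? : ∀ μ a b c → Dec (F3Coefficients μ a b c)
F3Coefficients? (μ₁ , μ₂ , μ₃) a b c =
  (ℚ.0ℚ ℚ.≤? a) ×-dec (a ℚ.<? ℚ.1ℚ) ×-dec (ℚ.0ℚ ℚ.≤? b) ×-dec (b ℚ.<? ℚ.1ℚ) ×-dec
  (ℚ.0ℚ ℚ.<? c) ×-dec (c ℚ.≤? ℚ.1ℚ) ×-dec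
  (toℚ μ₁ ℚ.≟ _) ×-dec (toℚ μ₂ ℚ.≟ _) ×-dec (toℚ μ₃ ℚ.≟ _)

-- partition a₁ a₂ a₃ has coordinates a₁/6, a₂/3, (a₃+1)/2 in the basis v₁, v₂, v₃; the 36 cases are decided by evaluation.
fundamental⇒InF3 : ∀ {a₁} → a₁ ℕ.< 6 → ∀ {a₂} → a₂ ℕ.< 3 → ∀ {a₃} → a₃ ℕ.< 2 → InF3 (partition a₁ a₂ a₃)
fundamental⇒InF3 a₁<6 a₂<3 a₃<2 = _ , _ , _ , coefficients a₁<6 a₂<3 a₃<2
  where
  coefficients : ∀ {a₁} → a₁ ℕ.< 6 → ∀ {a₂} → a₂ ℕ.< 3 → ∀ {a₃} → a₃ ℕ.< 2 →
    F3Coefficients (partition a₁ a₂ a₃) (+ a₁ ℚ./ 6) (+ a₂ ℚ./ 3) (+ suc a₃ ℚ./ 2)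
  coefficients = from-yes
    (ℕP.allUpTo? (λ a₁ → ℕP.allUpTo? (λ a₂ → ℕP.allUpTo? (λ a₃ →
      F3Coefficients? (partition a₁ a₂ a₃) (+ a₁ ℚ./ 6) (+ a₂ ℚ./ 3) (+ suc a₃ ℚ./ 2)) 2) 3) 6)

bounded-gaps⇒partition : ∀ {μ₁ μ₂ μ₃} → ℤ.0ℤ ℤ.< μ₃ → μ₃ ℤ.≤ + 2 → μ₃ ℤ.≤ μ₂ → μ₂ ℤ.< + 3 ℤ.+ μ₃ →
  μ₂ ℤ.≤ μ₁ → μ₁ ℤ.< + 6 ℤ.+ μ₂ →
  ∃[ a₁ ] ∃[ a₂ ] ∃[ a₃ ] (a₁ ℕ.< 6 × a₂ ℕ.< 3 × a₃ ℕ.< 2 × (μ₁ , μ₂ , μ₃) ≡ partition a₁ a₂ a₃)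
bounded-gaps⇒partition {μ₃ = + suc a₃} (+<+ _) (+≤+ (s≤s a₃≤1)) μ₃≤μ₂ μ₂<3+μ₃ μ₂≤μ₁ μ₁<6+μ₂
  with bounded-offset {k = 3} μ₃≤μ₂ μ₂<3+μ₃
... | a₂ , refl , a₂<3 with bounded-offset {k = 6} μ₂≤μ₁ μ₁<6+μ₂
... | a₁ , refl , a₁<6 = a₁ , a₂ , a₃ , a₁<6 , a₂<3 , s≤s a₃≤1 , refl

InF3⇒fundamental : ∀ {μ} → InF3 μ →
  ∃[ a₁ ] ∃[ a₂ ] ∃[ a₃ ] (a₁ ℕ.< 6 × a₂ ℕ.< 3 × a₃ ℕ.< 2 × μ ≡ partition a₁ a₂ a₃)
InF3⇒fundamental {μ₁ , μ₂ , μ₃} (a , b , c , 0≤a , a<1 , 0≤b , b<1 , 0<c , c≤1 , eq₁ , eq₂ , eq₃)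
  with scaled-fraction-bounds′ (+ 2) 0<c c≤1 eq₃
     | scaled-fraction-bounds (+ 3) 0≤b b<1 eq₂′
     | scaled-fraction-bounds (+ 6) 0≤a a<1 eq₁′
  where
  eq₂′ : toℚ μ₂ ≡ toℚ (+ 3) ℚ.* b ℚ.+ toℚ μ₃
  eq₂′ = trans eq₂ (cong (toℚ (+ 3) ℚ.* b ℚ.+_) (sym eq₃))
  eq₁′ : toℚ μ₁ ≡ toℚ (+ 6) ℚ.* a ℚ.+ toℚ μ₂
  eq₁′ = trans eq₁ (trans (ℚP.+-assoc (toℚ (+ 6) ℚ.* a) (toℚ (+ 3) ℚ.* b) (toℚ (+ 2) ℚ.* c))
                          (cong (toℚ (+ 6) ℚ.* a ℚ.+_) (sym eq₂)))
... | 0<μ₃ , μ₃≤2 | μ₃≤μ₂ , μ₂<3+μ₃ | μ₂≤μ₁ , μ₁<6+μ₂ = bounded-gaps⇒partition 0<μ₃ μ₃≤2 μ₃≤μ₂ μ₂<3+μ₃ μ₂≤μ₁ μ₁<6+μ₂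

Decomp⇒digits : ∀ {l μ τ} → Decomp l μ τ →
  ∃[ e₁ ] ∃[ e₂ ] ∃[ e₃ ] ∃[ t₁ ] ∃[ t₂ ] ∃[ t₃ ]
    (e₁ ℕ.< 6 × e₂ ℕ.< 3 × e₃ ℕ.< 2 × μ ≡ partition e₁ e₂ e₃ × τ ≡ (+ t₁ , + t₂ , + t₃) ×
     l ≡ partition (e₁ ℕ.+ t₁ ℕ.* 6) (e₂ ℕ.+ t₂ ℕ.* 3) (e₃ ℕ.+ t₃ ℕ.* 2))
Decomp⇒digits {μ = μ} {τ} (μ∈F₃ , τ≥0 , l≡μ+Vτ) with InF3⇒fundamental {μ} μ∈F₃ | NonNeg⇒ℕ³ {τ} τ≥0
... | e₁ , e₂ , e₃ , e₁<6 , e₂<3 , e₃<2 , refl | t₁ , t₂ , t₃ , refl =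
  e₁ , e₂ , e₃ , t₁ , t₂ , t₃ , e₁<6 , e₂<3 , e₃<2 , refl , refl ,
  trans l≡μ+Vτ (partition-+V-V3mul e₁ e₂ e₃ t₁ t₂ t₃)

Decomp-unique : ∀ {l μ τ μ' τ'} → Decomp l μ τ → Decomp l μ' τ' → μ ≡ μ' × τ ≡ τ'
Decomp-unique {l} {μ} {τ} {μ'} {τ'} d d' with Decomp⇒digits {l} {μ} {τ} d | Decomp⇒digits {l} {μ'} {τ'} d'
... | _ , _ , _ , t₁ , t₂ , t₃ , e₁<6 , e₂<3 , e₃<2 , refl , refl , refl
    | _ , _ , _ , t₁' , t₂' , t₃' , e₁'<6 , e₂'<3 , e₃'<2 , refl , refl , l≡
  with partition-injective l≡
... | eq₁ , eq₂ , eq₃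
  with divmod-injective {t = t₁} {t₁'} e₁<6 e₁'<6 eq₁
     | divmod-injective {t = t₂} {t₂'} e₂<3 e₂'<3 eq₂
     | divmod-injective {t = t₃} {t₃'} e₃<2 e₃'<2 eq₃
... | refl , refl | refl , refl | refl , refl = refl , refl

Decomp-exists : ∀ {n l} → InP n l → ∃[ μ ] ∃[ τ ] Decomp l μ τ
Decomp-exists p with InP⇒partition p
... | a₁ , a₂ , a₃ , refl =
  partition (a₁ % 6) (a₂ % 3) (a₃ % 2) , (+ (a₁ / 6) , + (a₂ / 3) , + (a₃ / 2)) ,
  fundamental⇒InF3 (ℕD.m%n<n a₁ 6) (ℕD.m%n<n a₂ 3) (ℕD.m%n<n a₃ 2) , (+≤+ z≤n , +≤+ z≤n , +≤+ z≤n) ,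
  trans (partition-cong (ℕD.m≡m%n+[m/n]*n a₁ 6) (ℕD.m≡m%n+[m/n]*n a₂ 3) (ℕD.m≡m%n+[m/n]*n a₃ 2))
        (sym (partition-+V-V3mul (a₁ % 6) (a₂ % 3) (a₃ % 2) (a₁ / 6) (a₂ / 3) (a₃ / 2)))

sum3-+V-V3mul : ∀ μ τ → sum3 (μ +V V3mul τ) ≡ sum3 μ ℤ.+ + 6 ℤ.* sum3 τ
sum3-+V-V3mul (μ₁ , μ₂ , μ₃) (t₁ , t₂ , t₃) = expand μ₁ μ₂ μ₃ t₁ t₂ t₃
  where
  expand : ∀ μ₁ μ₂ μ₃ t₁ t₂ t₃ →
    μ₁ ℤ.+ (+ 6 ℤ.* t₁ ℤ.+ + 3 ℤ.* t₂ ℤ.+ + 2 ℤ.* t₃) ℤ.+ (μ₂ ℤ.+ (+ 3 ℤ.* t₂ ℤ.+ + 2 ℤ.* t₃)) ℤ.+ (μ₃ ℤ.+ + 2 ℤ.* t₃) ≡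
    μ₁ ℤ.+ μ₂ ℤ.+ μ₃ ℤ.+ + 6 ℤ.* (t₁ ℤ.+ t₂ ℤ.+ t₃)
  expand = ℤSolver.solve-∀

quotient-nonneg : ∀ {n K r} → r ℕ.< 6 → + n ≡ + 6 ℤ.* K ℤ.+ + r → ∃[ k ] (K ≡ + k)
quotient-nonneg {K = + k} _ _ = k , refl
quotient-nonneg {n} { -[1+ k ]} {r} r<6 eq = contradiction (subst (ℤ.0ℤ ℤ.≤_) eq (+≤+ z≤n)) (ℤP.<⇒≱ negative)
  where
  open ℤP.≤-Reasoning
  telescope : ∀ K → + 6 ℤ.* ℤ.- (ℤ.1ℤ ℤ.+ K) ℤ.+ + 6 ≡ ℤ.- (+ 6 ℤ.* K)
  telescope = ℤSolver.solve-∀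
  negative : + 6 ℤ.* -[1+ k ] ℤ.+ + r ℤ.< ℤ.0ℤ
  negative = begin-strict
    + 6 ℤ.* -[1+ k ] ℤ.+ + r   <⟨ ℤP.+-monoʳ-< (+ 6 ℤ.* -[1+ k ]) (+<+ r<6) ⟩
    + 6 ℤ.* -[1+ k ] ℤ.+ + 6   ≡⟨ telescope (+ k) ⟩
    ℤ.- (+ 6 ℤ.* + k)          ≡⟨ cong ℤ.-_ (ℤP.pos-* 6 k) ⟨
    ℤ.- (+ (6 ℕ.* k))          ≤⟨ ℤP.neg-≤-pos ⟩
    ℤ.0ℤ                       ∎

fundamental-sum<18 : ∀ {e₁ e₂ e₃} → e₁ ℕ.< 6 → e₂ ℕ.< 3 → e₃ ℕ.< 2 →
                     suc e₃ ℕ.+ e₂ ℕ.+ e₁ ℕ.+ (suc e₃ ℕ.+ e₂) ℕ.+ suc e₃ ℕ.< 18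
fundamental-sum<18 {e₁} {e₂} {e₃} e₁<6 e₂<3 e₃<2 = subst (ℕ._< 18) (sym (rearrange e₁ e₂ e₃))
  (s≤s (ℕP.+-mono-≤ (ℕP.+-mono-≤ (ℕP.+-mono-≤ (ℕP.*-monoʳ-≤ 3 (ℕP.≤-pred e₃<2)) (ℕP.*-monoʳ-≤ 2 (ℕP.≤-pred e₂<3)))
                                 (ℕP.≤-pred e₁<6))
                    (ℕP.m≤m+n 3 2)))
  where
  rearrange : ∀ e₁ e₂ e₃ → suc e₃ ℕ.+ e₂ ℕ.+ e₁ ℕ.+ (suc e₃ ℕ.+ e₂) ℕ.+ suc e₃ ≡ 3 ℕ.* e₃ ℕ.+ 2 ℕ.* e₂ ℕ.+ e₁ ℕ.+ 3
  rearrange = ℕSolver.solve-∀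

-- For n = 6K + r split as s + 6T with s = sum μ < 18 and T = sum τ: the block index is i = s / 6,
-- so that μ ∈ H_{r+6i} and τ ∈ T_{K−i}.
level-split : ∀ {s T k r} → r ℕ.< 6 → s ℕ.< 18 → s ℕ.+ 6 ℕ.* T ≡ 6 ℕ.* k ℕ.+ r →
              ∃[ i ] (i ℕ.≤ 2 × s ≡ r ℕ.+ 6 ℕ.* i × k ≡ i ℕ.+ T)
level-split {s} {T} {k} {r} r<6 s<18 eq with divmod-injective {t = k} {s / 6 ℕ.+ T} r<6 (ℕD.m%n<n s 6) regrouped
  where
  regroup₁ : ∀ r k → r ℕ.+ k ℕ.* 6 ≡ 6 ℕ.* k ℕ.+ r
  regroup₁ = ℕSolver.solve-∀
  regroup₂ : ∀ u i T → u ℕ.+ i ℕ.* 6 ℕ.+ 6 ℕ.* T ≡ u ℕ.+ (i ℕ.+ T) ℕ.* 6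
  regroup₂ = ℕSolver.solve-∀
  regrouped : r ℕ.+ k ℕ.* 6 ≡ s % 6 ℕ.+ (s / 6 ℕ.+ T) ℕ.* 6
  regrouped = trans (regroup₁ r k) (trans (sym eq)
    (trans (cong (ℕ._+ 6 ℕ.* T) (ℕD.m≡m%n+[m/n]*n s 6)) (regroup₂ (s % 6) (s / 6) T)))
... | r≡s%6 , k≡i+T =
  s / 6 , ℕP.≤-pred (ℕD.m<n*o⇒m/o<n {s} {3} {6} s<18) ,
  trans (ℕD.m≡m%n+[m/n]*n s 6) (cong₂ ℕ._+_ (sym r≡s%6) (ℕP.*-comm (s / 6) 6)) , k≡i+T

Decomp-level : ∀ {n K r l μ τ} → r ℕ.< 6 → + n ≡ + 6 ℤ.* K ℤ.+ + r → InP (+ n) l → Decomp l μ τ →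
               ∃[ i ] (Idx r i μ × InT (K ℤ.- + i) τ)
Decomp-level {n} {K} {r} {l} {μ} {τ} r<6 n≡6K+r λ∈P d@(μ∈F₃ , τ≥0 , l≡μ+Vτ)
  with Decomp⇒digits {l} {μ} {τ} d | quotient-nonneg {n} {K} r<6 n≡6K+r
... | e₁ , e₂ , e₃ , t₁ , t₂ , t₃ , e₁<6 , e₂<3 , e₃<2 , refl , refl , _ | k , refl
  with level-split {s} {T} {k} r<6 (fundamental-sum<18 e₁<6 e₂<3 e₃<2) s+6T≡6k+r
  where
  s = suc e₃ ℕ.+ e₂ ℕ.+ e₁ ℕ.+ (suc e₃ ℕ.+ e₂) ℕ.+ suc e₃
  T = t₁ ℕ.+ t₂ ℕ.+ t₃
  s+6T≡6k+r : s ℕ.+ 6 ℕ.* T ≡ 6 ℕ.* k ℕ.+ r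
  s+6T≡6k+r = ℤP.+-injective (begin
    + (s ℕ.+ 6 ℕ.* T)                ≡⟨ cong (λ t → + s ℤ.+ t) (ℤP.pos-* 6 T) ⟩
    + s ℤ.+ + 6 ℤ.* + T              ≡⟨ sum3-+V-V3mul μ τ ⟨
    sum3 (μ +V V3mul τ)              ≡⟨ cong sum3 l≡μ+Vτ ⟨
    sum3 l                           ≡⟨ proj₁ λ∈P ⟩
    + n                              ≡⟨ n≡6K+r ⟩
    + 6 ℤ.* + k ℤ.+ + r              ≡⟨ cong (ℤ._+ + r) (ℤP.pos-* 6 k) ⟨
    + (6 ℕ.* k ℕ.+ r)                ∎)
    where open ≡-Reasoning
... | i , i≤2 , s≡r+6i , refl = i , (i≤2 , μ∈F₃ , cong +_ s≡r+6i) , τ≥0 , T≡[i+T]-i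
  where
  T≡[i+T]-i : + (t₁ ℕ.+ t₂ ℕ.+ t₃) ≡ + (i ℕ.+ (t₁ ℕ.+ t₂ ℕ.+ t₃)) ℤ.- + i
  T≡[i+T]-i = trans (cancel (+ i) _) (cong (ℤ._- + i) (sym (ℤP.pos-+ i _)))
    where
    cancel : ∀ I T → T ≡ I ℤ.+ T ℤ.- I
    cancel = ℤSolver.solve-∀

level-sum : ∀ {n K r i μ τ} → + n ≡ + 6 ℤ.* K ℤ.+ + r → sum3 μ ≡ + (r ℕ.+ 6 ℕ.* i) → sum3 τ ≡ K ℤ.- + i →
            sum3 (μ +V V3mul τ) ≡ + n
level-sum {n} {K} {r} {i} {μ} {τ} n≡6K+r sum-μ sum-τ = begin
  sum3 (μ +V V3mul τ)                         ≡⟨ sum3-+V-V3mul μ τ ⟩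
  sum3 μ ℤ.+ + 6 ℤ.* sum3 τ                   ≡⟨ cong₂ (λ u v → u ℤ.+ + 6 ℤ.* v) sum-μ sum-τ ⟩
  + (r ℕ.+ 6 ℕ.* i) ℤ.+ + 6 ℤ.* (K ℤ.- + i)   ≡⟨ cong (ℤ._+ + 6 ℤ.* (K ℤ.- + i)) (ℤP.pos-+ r (6 ℕ.* i)) ⟩
  + r ℤ.+ + (6 ℕ.* i) ℤ.+ + 6 ℤ.* (K ℤ.- + i) ≡⟨ cong (λ t → + r ℤ.+ t ℤ.+ + 6 ℤ.* (K ℤ.- + i)) (ℤP.pos-* 6 i) ⟩
  + r ℤ.+ + 6 ℤ.* + i ℤ.+ + 6 ℤ.* (K ℤ.- + i) ≡⟨ telescope (+ r) (+ i) K ⟩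
  + 6 ℤ.* K ℤ.+ + r                           ≡⟨ n≡6K+r ⟨
  + n                                         ∎
  where
  open ≡-Reasoning
  telescope : ∀ r i K → r ℤ.+ + 6 ℤ.* i ℤ.+ + 6 ℤ.* (K ℤ.- i) ≡ + 6 ℤ.* K ℤ.+ r
  telescope = ℤSolver.solve-∀

level⇒InP : ∀ {n K r i μ τ} → + n ≡ + 6 ℤ.* K ℤ.+ + r → Idx r i μ → InT (K ℤ.- + i) τ → InP (+ n) (μ +V V3mul τ)
level⇒InP {n} {K} {r} {i} {μ} {τ} n≡6K+r (_ , μ∈F₃ , sum-μ) (τ≥0 , sum-τ)
  with InF3⇒fundamental {μ} μ∈F₃ | NonNeg⇒ℕ³ {τ} τ≥0
... | e₁ , e₂ , e₃ , _ , _ , _ , refl | t₁ , t₂ , t₃ , refl =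
  subst (InP (+ n)) (sym (partition-+V-V3mul e₁ e₂ e₃ t₁ t₂ t₃))
    (partition-InP _ _ _ (trans (cong sum3 (sym (partition-+V-V3mul e₁ e₂ e₃ t₁ t₂ t₃)))
                                (level-sum {n} {K} {r} {i} {μ} {τ} n≡6K+r sum-μ sum-τ)))

level-unique : ∀ {r i i' μ} → Idx r i μ → Idx r i' μ → i ≡ i'
level-unique {r} {i} {i'} (_ , _ , sum≡r+6i) (_ , _ , sum≡r+6i') =
  ℕP.*-cancelˡ-≡ i i' 6 (ℕP.+-cancelˡ-≡ r _ _ (ℤP.+-injective (trans (sym sum≡r+6i) sum≡r+6i')))

T₀-unique : ∀ {τ} → InT ℤ.0ℤ τ → τ ≡ (ℤ.0ℤ , ℤ.0ℤ , ℤ.0ℤ)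
T₀-unique {τ} (τ≥0 , sum≡0) with NonNeg⇒ℕ³ {τ} τ≥0
... | t₁ , t₂ , t₃ , refl with ℤP.+-injective sum≡0
... | t₁+t₂+t₃≡0 rewrite ℕP.m+n≡0⇒n≡0 (t₁ ℕ.+ t₂) t₁+t₂+t₃≡0
                      | ℕP.m+n≡0⇒n≡0 t₁ (ℕP.m+n≡0⇒m≡0 (t₁ ℕ.+ t₂) t₁+t₂+t₃≡0)
                      | ℕP.m+n≡0⇒m≡0 t₁ (ℕP.m+n≡0⇒m≡0 (t₁ ℕ.+ t₂) t₁+t₂+t₃≡0) = refl

T-injective : ∀ {r ψ i μ s τ τ'} → PsiInjective r ψ → Idx r i μ → InT s τ → InT s τ' →
              app (ψ μ) τ ≡ app (ψ μ) τ' → τ ≡ τ'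
T-injective {s = + suc _} ψ-injective idx τ∈T τ'∈T = ψ-injective _ _ idx _ (+≤+ (s≤s z≤n)) _ _ τ∈T τ'∈T
T-injective {s = + zero} _ _ τ∈T τ'∈T _ = trans (T₀-unique τ∈T) (sym (T₀-unique τ'∈T))
T-injective {s = -[1+ _ ]} {τ} _ _ (τ≥0 , sum≡s) _ _ with NonNeg⇒ℕ³ {τ} τ≥0
... | _ , _ , _ , refl with sum≡s
... | ()

InP? : ∀ n l → Dec (InP n l)
InP? n (l₁ , l₂ , l₃) = (l₁ ℤ.+ l₂ ℤ.+ l₃ ℤ.≟ n) ×-dec (l₂ ℤ.≤? l₁) ×-dec (l₃ ℤ.≤? l₂) ×-dec (ℤ.0ℤ ℤ.<? l₃)

ψφ-chart : ∀ {n K r ψ L₁ L₂} → r ℕ.< 6 → + n ≡ + 6 ℤ.* K ℤ.+ + r →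
           PsiInjective r ψ → PsiTiling r ψ K L₁ L₂ → Chart (InP (+ n)) (PsiPhi ψ) L₁ L₂
ψφ-chart {n} {K} {r} {ψ} {L₁} {L₂} r<6 n≡6K+r ψ-injective (disjoint , into , onto) = record
  { total      = total
  ; within     = within
  ; functional = functional
  ; surjective = surjective
  ; injective  = λ {l l' x y} → injective {l} {l'} {x} {y}
  }
  where
  level : ∀ l μ τ → InP (+ n) l → Decomp l μ τ → ∃[ i ] (Idx r i μ × InT (K ℤ.- + i) τ)
  level l μ τ = Decomp-level {n} {K} {r} {l} {μ} {τ} r<6 n≡6K+r

  total : ∀ {l} → InP (+ n) l → ∃[ x ] ∃[ y ] PsiPhi ψ l x y
  total {l} p with Decomp-exists {+ n} {l} p
  ... | μ , τ , d with level l μ τ p d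
  ... | i , idx , τ∈T with into i μ τ idx τ∈T
  ... | x , y , _ , ψμτ≡xy = x , y , μ , τ , d , ψμτ≡xy

  within : ∀ {l x y} → InP (+ n) l → PsiPhi ψ l x y → InR L₁ L₂ x y
  within {l} {x} {y} p (μ , τ , d , ψμτ≡xy) with level l μ τ p d
  ... | i , idx , τ∈T with into i μ τ idx τ∈T
  ... | x′ , y′ , inR , ψμτ≡x′y′ with pt-injective {x} {y} {x′} {y′} (trans (sym ψμτ≡xy) ψμτ≡x′y′)
  ... | refl , refl = inR

  functional : ∀ {l x y x' y'} → InP (+ n) l → PsiPhi ψ l x y → PsiPhi ψ l x' y' → x ≡ x' × y ≡ y'
  functional {l} {x} {y} {x'} {y'} _ (μ , τ , d , ψμτ≡xy) (μ' , τ' , d' , ψμ'τ'≡x'y')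
    with Decomp-unique {l} {μ} {τ} {μ'} {τ'} d d'
  ... | refl , refl = pt-injective {x} {y} {x'} {y'} (trans (sym ψμτ≡xy) ψμ'τ'≡x'y')

  surjective : ∀ {x y} → InR L₁ L₂ x y → ∃[ l ] (InP (+ n) l × PsiPhi ψ l x y)
  surjective {x} {y} inR with onto x y inR
  ... | i , μ , τ , idx@(_ , μ∈F₃ , _) , τ∈T@(τ≥0 , _) , ψμτ≡xy =
    μ +V V3mul τ , level⇒InP {n} {K} {r} {i} {μ} {τ} n≡6K+r idx τ∈T , μ , τ , (μ∈F₃ , τ≥0 , refl) , ψμτ≡xy

  injective : ∀ {l l' x y} → InP (+ n) l → InP (+ n) l' → PsiPhi ψ l x y → PsiPhi ψ l' x y → l ≡ l'
  injective {l} {l'} p p' (μ , τ , d , ψμτ≡xy) (μ' , τ' , d' , ψμ'τ'≡xy) with level l μ τ p d | level l' μ' τ' p' d'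
  ... | i , idx , τ∈T | i' , idx' , τ'∈T with disjoint i i' μ μ' τ τ' idx idx' τ∈T τ'∈T (trans ψμτ≡xy (sym ψμ'τ'≡xy))
  ... | refl with level-unique {r} {i} {i'} {μ} idx idx'
  ... | refl with T-injective {r} {ψ} {i} {μ} {K ℤ.- + i} {τ} {τ'} ψ-injective idx τ∈T τ'∈T (trans ψμτ≡xy (sym ψμ'τ'≡xy))
  ... | refl = trans (proj₂ (proj₂ d)) (sym (proj₂ (proj₂ d')))

theorem3 :
    (m : ℕ) {{_ : NonZero m}} (r' : ℕ) (r : ℕ) → r ℕ.≤ 5 →
    (k : ℤ → ℤ) →
    (∀ (k' : ℕ) → + (6 ℕ.* m ℕ.* k' ℕ.+ r') ≡ (+ 6) ℤ.* k (+ k') ℤ.+ + r) →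
    (ℓ₁ ℓ₂ : ℤ → ℤ) →
    (ψ : V3 → Affine) →
    PsiInjective r ψ →
    (∀ (k' : ℕ) → PsiTiling r ψ (k (+ k')) (ℓ₁ (+ k')) (ℓ₂ (+ k'))) →
    (α β γ : ℤ) →
    ((gcd α (+ m) ≡ + 1) → (∀ (k' : ℕ) → (+ m) ℤd.∣ ℓ₁ (+ k')) →
      ∀ (k' : ℕ) →
        (∀ N → HasCard (InP (+ (6 ℕ.* m ℕ.* k' ℕ.+ r'))) N →
          (m ℕd.∣ N) ×
          (∀ j → j ℕ.< m →
            HasCard (λ l → InP (+ (6 ℕ.* m ℕ.* k' ℕ.+ r')) l × Colour m ψ α β γ l j) (N ℕ./ m))) ×
        (Σ (V3 → V3) λ σ →
          PermCycles (InP (+ (6 ℕ.* m ℕ.* k' ℕ.+ r'))) σ ∣ ℓ₁ (+ k') ∣ ×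
          (∀ l → InP (+ (6 ℕ.* m ℕ.* k' ℕ.+ r')) l → ∀ x y → PsiPhi ψ l x y →
            ∀ x' → ℤ.0ℤ ℤ.≤ x' → x' ℤ.≤ ℓ₁ (+ k') ℤ.- ℤ.1ℤ →
            ℓ₁ (+ k') ℤd.∣ (x ℤ.+ ℤ.1ℤ ℤ.- x') → PsiPhi ψ (σ l) x' y))) ×
    ((gcd β (+ m) ≡ + 1) → (∀ (k' : ℕ) → (+ m) ℤd.∣ ℓ₂ (+ k')) →
      ∀ (k' : ℕ) →
        (∀ N → HasCard (InP (+ (6 ℕ.* m ℕ.* k' ℕ.+ r'))) N →
          (m ℕd.∣ N) ×
          (∀ j → j ℕ.< m →
            HasCard (λ l → InP (+ (6 ℕ.* m ℕ.* k' ℕ.+ r')) l × Colour m ψ α β γ l j) (N ℕ./ m))) ×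
        (Σ (V3 → V3) λ σ →
          PermCycles (InP (+ (6 ℕ.* m ℕ.* k' ℕ.+ r'))) σ ∣ ℓ₂ (+ k') ∣ ×
          (∀ l → InP (+ (6 ℕ.* m ℕ.* k' ℕ.+ r')) l → ∀ x y → PsiPhi ψ l x y →
            ∀ y' → ℤ.0ℤ ℤ.≤ y' → y' ℤ.≤ ℓ₂ (+ k') ℤ.- ℤ.1ℤ →
            ℓ₂ (+ k') ℤd.∣ (y ℤ.+ ℤ.1ℤ ℤ.- y') → PsiPhi ψ (σ l) x y')))
theorem3 m r' r r≤5 k n≡6k+r ℓ₁ ℓ₂ ψ ψ-injective tiling α β γ =
  (λ coprime m∣ℓ₁ k' → chart-conclusion {a = α} {β} {γ} (InP? _) (chart k') coprime (m∣ℓ₁ k')) ,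
  (λ coprime m∣ℓ₂ k' → transposed-conclusion {a = α} {β} {γ} (InP? _) (chart k') coprime (m∣ℓ₂ k'))
  where
  chart : ∀ k' → Chart (InP (+ (6 ℕ.* m ℕ.* k' ℕ.+ r'))) (PsiPhi ψ) (ℓ₁ (+ k')) (ℓ₂ (+ k'))
  chart k' = ψφ-chart {K = k (+ k')} {ψ = ψ} (s≤s r≤5) (n≡6k+r k') ψ-injective (tiling k')
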